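{- Let $d\in\mathbb N$, $0\le\delta<1$, $1\le k\le N$, $1\le m\le N$, and $G=G(N,d,\delta)$. Then the probability that some set $U$ of $k$ left vertices has fewer than $m$ neighbours is at most $$\binom N{m-1}\left(\frac{\binom{m-1}k}{\binom Nk}\right)^d\sum_{i=0}^k\binom{\lfloor\delta N\rfloor}i\binom{N-\lfloor\delta N\rfloor}{k-i}\binom{m-1}i\Big/\binom Ni,$$ which for $\delta=0$ reduces to $\binom Nk\binom N{m-1}\left(\binom{m-1}k/\binom Nk\right)^d$.
   Context: $G(N,d,\delta)$ is the random bipartite (multi)graph with left vertices $l_1,\dots,l_N$, right vertices $r_1,\dots,r_N$, edges directed left to right: the edges $(l_i,r_{\pi_j(i)})$ for $j=1,\dots,d$, $i=1,\dots,N$, where $\pi_1,\dots,\pi_d$ are independent uniformly random permutations of $\{1,\dots,N\}$, plus the edges $(l_i,r_i)$ for $1\le i\le\lfloor\delta N\rfloor$. Convention: $\binom nk=0$ for $k<0$ or $k>n$.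
   Formalization: The parameter δ takes rational values in [0,1). -}

module Defs where

open import Data.Bool using (Bool; true; false; _∧_; _∨_; if_then_else_)
open import Data.Nat using (ℕ; zero; suc; _<ᵇ_; _∸_)
open import Data.Nat.Combinatorics using (_C_)
open import Data.Fin using (Fin; toℕ)
open import Data.Fin.Properties using (_≟_)
open import Data.Fin.Subset using (Subset; ∣_∣)
open import Data.Vec using (Vec; []; _∷_; lookup; tabulate; toList)
open import Data.List using (List; []; _∷_; map; concatMap; filter; length; allFin; upTo; foldr)
open import Data.Integer using (+_)
import Data.Integer as ℤ
open import Data.Rational using (ℚ; 0ℚ; 1ℚ; _+_; _*_; _/_; floor)
open import Relation.Nullary.Decidable using (does)
open import Data.Bool.ListAction using (any)
import Data.List.Relation.Unary.Unique.DecPropositional as UniqueDec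

allVecs : {A : Set} → List A → (n : ℕ) → List (Vec A n)
allVecs xs zero    = [] ∷ []
allVecs xs (suc n) = concatMap (λ x → map (x ∷_) (allVecs xs n)) xs

-- a permutation of {1..N} (0-indexed as Fin N) is represented by its
-- vector of values (π(0),…,π(N-1)); it is a permutation iff injective
IsPerm? : {N : ℕ} → (v : Vec (Fin N) N) → _
IsPerm? {N} v = UniqueDec.unique? (_≟_ {N}) (toList v)

allPerms : (N : ℕ) → List (Vec (Fin N) N)
allPerms N = filter IsPerm? (allVecs (allFin N) N)

-- sample space: all d-tuples (π_1,…,π_d) of permutations, uniform
allPermTuples : (N d : ℕ) → List (Vec (Vec (Fin N) N) d)
allPermTuples N d = allVecs (allPerms N) d

allSubsets : (N : ℕ) → List (Subset N)
allSubsets N = allVecs (true ∷ false ∷ []) N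

anyFin : {n : ℕ} → (Fin n → Bool) → Bool
anyFin {n} p = any p (allFin n)

-- is (l_i , r_j) an edge of G(N,d,δ), where D = ⌊δN⌋ ?
edge : {N d : ℕ} → (D : ℕ) → Vec (Vec (Fin N) N) d → Fin N → Fin N → Bool
edge D πs i j =
  anyFin (λ t → does (lookup (lookup πs t) i ≟ j)) ∨ (does (i ≟ j) ∧ (toℕ i <ᵇ D))

nbhd : {N d : ℕ} → (D : ℕ) → Vec (Vec (Fin N) N) d → Subset N → Subset N
nbhd D πs U = tabulate (λ j → anyFin (λ i → lookup U i ∧ edge D πs i j))

badEvent : {N d : ℕ} → (D k m : ℕ) → Vec (Vec (Fin N) N) d → Bool
badEvent {N} D k m πs =
  any (λ U → does (∣ U ∣ Data.Nat.≟ k) ∧ (∣ nbhd D πs U ∣ <ᵇ m)) (allSubsets N)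

ℕtoℚ : ℕ → ℚ
ℕtoℚ n = + n / 1

-- division of a rational by a natural number (never used with 0 below)
_÷ℕ_ : ℚ → ℕ → ℚ
p ÷ℕ zero  = 0ℚ
p ÷ℕ suc n = p * (+ 1 / suc n)

_^ℚ_ : ℚ → ℕ → ℚ
p ^ℚ zero  = 1ℚ
p ^ℚ suc n = p * (p ^ℚ n)

probBad : (N d D k m : ℕ) → ℚ
probBad N d D k m =
  ℕtoℚ (length (filter (λ πs → badEvent D k m πs Data.Bool.≟ true) (allPermTuples N d)))
    ÷ℕ length (allPermTuples N d)

-- ⌊ δ N ⌋ as a natural number (δ ≥ 0)
floorMul : ℚ → ℕ → ℕ
floorMul δ N = ℤ.∣ floor (δ * ℕtoℚ N) ∣

sumTo : ℕ → (ℕ → ℚ) → ℚ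
sumTo k f = foldr (λ i acc → f i + acc) 0ℚ (upTo (suc k))

bound : (N d D k m : ℕ) → ℚ
bound N d D k m =
  ℕtoℚ (N C (m ∸ 1)) * ((ℕtoℚ ((m ∸ 1) C k) ÷ℕ (N C k)) ^ℚ d)
    * sumTo k (λ i → ℕtoℚ ((D C i) Data.Nat.* ((N ∸ D) C (k ∸ i)) Data.Nat.* ((m ∸ 1) C i)) ÷ℕ (N C i))

bound0 : (N d k m : ℕ) → ℚ
bound0 N d k m =
  ℕtoℚ (N C k) * ℕtoℚ (N C (m ∸ 1)) * ((ℕtoℚ ((m ∸ 1) C k) ÷ℕ (N C k)) ^ℚ d)

module Submission where

-- If some k-set U of left vertices has at most m − 1 neighbours, enlarge its neighbourhood to an
-- (m − 1)-set W. Then π_t(U) ⊆ W for every t, and W contains U ∩ {1,…,⌊δN⌋} because of the diagonal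
-- edges. For a fixed pair (U, W) the d permutations are independent and each maps U into W with
-- probability ((m−1) C k)/(N C k). By the union bound over pairs, grouped by i = |U ∩ {1,…,⌊δN⌋}|,
-- there are at most (⌊δN⌋ C i)((N−⌊δN⌋) C (k−i)) such U and (N−i) C (m−1−i) = (N C (m−1))((m−1) C i)/(N C i)
-- such W. Everything is an exact count over the finite sample space of d-tuples of permutations.

open import Defs
open import Algebra using (CommutativeMonoid)
import Algebra.Properties.CommutativeSemigroup as CommSemigroupProperties
open import Data.Bool using (Bool; true; false; _∧_; _∨_; not; T)
open import Data.Bool.ListAction using (any)
open import Data.Bool.Properties using (∧-assoc; ∧-identityʳ; ∧-zeroʳ; ∧-conicalˡ; ∧-conicalʳ; ∨-zeroʳ; T-≡; ∧-commutativeMonoid)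
import Data.Bool as Bool
open import Data.Fin using (Fin; zero; suc; toℕ)
open import Data.Fin.Properties using (_≟_)
open import Data.Fin.Subset using (Subset; ∣_∣; ⊥)
open import Data.Fin.Subset.Properties using (∣⊥∣≡0; ∣p∣≤n)
open import Data.List using (List; []; _∷_; _++_; map; concatMap; filter; length; allFin; applyUpTo; foldr)
open import Data.List.Properties using (length-tabulate; map-tabulate)
open import Data.List.Relation.Unary.All using (all?)
open import Data.List.Relation.Unary.Any using (here; satisfied)
open import Data.List.Relation.Unary.Any.Properties using (any⁺; any⁻)
open import Data.List.Membership.Propositional using (_∈_; lose)
open import Data.List.Membership.Propositional.Properties using (∈-map⁺; ∈-++⁺ˡ; ∈-++⁺ʳ; ∈-allFin)
import Data.List.Relation.Unary.Unique.DecPropositional as UniqueDec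
open import Data.Nat using (ℕ; zero; suc; _+_; _*_; _∸_; _^_; _!; _≤_; _<_; z≤n; s≤s; _≡ᵇ_; _<ᵇ_; >-nonZero)
open import Data.Nat.Properties hiding (_≟_)
open import Data.Nat.Combinatorics
  using (_C_; nCk≡n!/k![n-k]!; k>n⇒nCk≡0; nCk+nC[k+1]≡[n+1]C[k+1]; k![n∸k]!∣n!)
open import Data.Nat.Combinatorics.Base using (_P′_)
open import Data.Nat.Combinatorics.Specification using (nP′k≡n!/[n∸k]!; nP′k≡n[n∸1P′k∸1])
open import Data.Nat.DivMod using (m/n*n≡m)
open import Data.Nat.Divisibility using (m≤n⇒m!∣n!)
open import Data.Sum using (inj₁; inj₂)
import Data.Integer as ℤ
import Data.Integer.Properties as ℤP
open import Data.Nat.Coprimality using (1-coprimeTo)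
import Data.Nat.Coprimality as Coprime
open import Data.Rational using (ℚ; 0ℚ; 1ℚ; toℚᵘ)
  renaming (_+_ to _+ℚ_; _*_ to _*ℚ_; _≤_ to _≤ℚ_; _<_ to _<ℚ_)
import Data.Rational as ℚ
open import Data.Rational.Properties using (normalize-coprime; toℚᵘ-injective; toℚᵘ-homo-*; toℚᵘ-homo-+; toℚᵘ-cancel-≤)
import Data.Rational.Properties as ℚP
open import Data.Rational.Unnormalised using (mkℚᵘ; *≡*; *≤*) renaming (_≃_ to _≃ᵘ_; _*_ to _*ᵘ_; _+_ to _+ᵘ_)
import Data.Rational.Unnormalised.Properties as ℚᵘP
open import Relation.Nullary using (yes; no)
open import Data.Product using (Σ-syntax; _×_; _,_)
open import Data.Vec using (Vec; []; _∷_; lookup; toList)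
open import Data.Vec.Properties using (lookup∘tabulate)
open import Function using (_∘_; id; mk⇔; Equivalence)
open import Level using (Level)
open import Relation.Binary.PropositionalEquality
open import Relation.Nullary.Decidable using (does; ¬?; dec-true; does-⇔)
open import Relation.Unary using (Pred; Decidable)

private
  variable
    A B : Set

open CommSemigroupProperties +-commutativeSemigroup using () renaming (interchange to +-interchange)
open CommSemigroupProperties *-commutativeSemigroup using () renaming (x∙yz≈y∙xz to *-leftSwap)
open CommSemigroupProperties (CommutativeMonoid.commutativeSemigroup ∧-commutativeMonoid)
  using () renaming (interchange to ∧-interchange)

≡ᵇ-true⇒≡ : ∀ m n → (m ≡ᵇ n) ≡ true → m ≡ n
≡ᵇ-true⇒≡ m n eq = ≡ᵇ⇒≡ m n (subst T (sym eq) _)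

𝟙 : Bool → ℕ
𝟙 true  = 1
𝟙 false = 0

sumBy : (A → ℕ) → List A → ℕ
sumBy f []       = 0
sumBy f (x ∷ xs) = f x + sumBy f xs

count : (A → Bool) → List A → ℕ
count p xs = sumBy (λ x → 𝟙 (p x)) xs

𝟙-∧ : ∀ a b → 𝟙 (a ∧ b) ≡ 𝟙 a * 𝟙 b
𝟙-∧ true  b = sym (+-identityʳ (𝟙 b))
𝟙-∧ false b = refl

𝟙-∨ : ∀ a b → 𝟙 (a ∨ b) ≤ 𝟙 a + 𝟙 b
𝟙-∨ true  b = s≤s z≤n
𝟙-∨ false b = ≤-refl

sumBy-++ : (f : A → ℕ) (xs ys : List A) → sumBy f (xs ++ ys) ≡ sumBy f xs + sumBy f ys
sumBy-++ f []       ys = refl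
sumBy-++ f (x ∷ xs) ys = trans (cong (f x +_) (sumBy-++ f xs ys)) (sym (+-assoc (f x) _ _))

sumBy-map : (f : B → ℕ) (g : A → B) (xs : List A) → sumBy f (map g xs) ≡ sumBy (f ∘ g) xs
sumBy-map f g []       = refl
sumBy-map f g (x ∷ xs) = cong (f (g x) +_) (sumBy-map f g xs)

sumBy-concatMap : (f : B → ℕ) (g : A → List B) (xs : List A) →
                  sumBy f (concatMap g xs) ≡ sumBy (sumBy f ∘ g) xs
sumBy-concatMap f g []       = refl
sumBy-concatMap f g (x ∷ xs) =
  trans (sumBy-++ f (g x) (concatMap g xs)) (cong (sumBy f (g x) +_) (sumBy-concatMap f g xs))

sumBy-cong : {f g : A → ℕ} (xs : List A) → (∀ x → f x ≡ g x) → sumBy f xs ≡ sumBy g xs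
sumBy-cong []       f≗g = refl
sumBy-cong (x ∷ xs) f≗g = cong₂ _+_ (f≗g x) (sumBy-cong xs f≗g)

sumBy-mono : {f g : A → ℕ} (xs : List A) → (∀ x → f x ≤ g x) → sumBy f xs ≤ sumBy g xs
sumBy-mono []       f≤g = z≤n
sumBy-mono (x ∷ xs) f≤g = +-mono-≤ (f≤g x) (sumBy-mono xs f≤g)

sumBy-zero : (xs : List A) → sumBy (λ _ → 0) xs ≡ 0
sumBy-zero []       = refl
sumBy-zero (x ∷ xs) = sumBy-zero xs

sumBy-+ : (f g : A → ℕ) (xs : List A) → sumBy (λ x → f x + g x) xs ≡ sumBy f xs + sumBy g xs
sumBy-+ f g []       = refl
sumBy-+ f g (x ∷ xs) =
  trans (cong (f x + g x +_) (sumBy-+ f g xs)) (+-interchange (f x) (g x) _ _)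

sumBy-*ʳ : (f : A → ℕ) (c : ℕ) (xs : List A) → sumBy (λ x → f x * c) xs ≡ sumBy f xs * c
sumBy-*ʳ f c []       = refl
sumBy-*ʳ f c (x ∷ xs) =
  trans (cong (f x * c +_) (sumBy-*ʳ f c xs)) (sym (*-distribʳ-+ c (f x) (sumBy f xs)))

sumBy-filter : {p : Level} {P : Pred A p} (P? : Decidable P) (g : A → ℕ) (xs : List A) →
               sumBy g (filter P? xs) ≡ sumBy (λ x → 𝟙 (does (P? x)) * g x) xs
sumBy-filter P? g [] = refl
sumBy-filter P? g (x ∷ xs) with does (P? x)
... | true  = cong₂ _+_ (sym (+-identityʳ (g x))) (sumBy-filter P? g xs)
... | false = sumBy-filter P? g xs

count-cong : {p q : A → Bool} (xs : List A) → (∀ x → p x ≡ q x) → count p xs ≡ count q xs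
count-cong xs p≗q = sumBy-cong xs (cong 𝟙 ∘ p≗q)

count-mono : {p q : A → Bool} (xs : List A) → (∀ x → p x ≡ true → q x ≡ true) → count p xs ≤ count q xs
count-mono {p = p} {q} xs p⇒q = sumBy-mono xs 𝟙-mono
  where
  𝟙-mono : ∀ x → 𝟙 (p x) ≤ 𝟙 (q x)
  𝟙-mono x with p x in px
  ... | false = z≤n
  ... | true  rewrite p⇒q x px = ≤-refl

length≡count-true : (xs : List A) → length xs ≡ count (λ _ → true) xs
length≡count-true []       = refl
length≡count-true (x ∷ xs) = cong suc (length≡count-true xs)

length-filter-true : (p : A → Bool) (xs : List A) →
                     length (filter (λ x → p x Bool.≟ true) xs) ≡ count p xs
length-filter-true p [] = refl
length-filter-true p (x ∷ xs) with p x
... | true  = cong suc (length-filter-true p xs)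
... | false = length-filter-true p xs

count-guarded : (b : Bool) (p : A → Bool) (xs : List A) → count (λ x → b ∧ p x) xs ≡ 𝟙 b * count p xs
count-guarded true  p xs = sym (+-identityʳ (count p xs))
count-guarded false p xs = sumBy-zero xs

count-∧-false : (p : A → Bool) (xs : List A) → count (λ x → p x ∧ false) xs ≡ 0
count-∧-false p xs = trans (count-cong xs (∧-zeroʳ ∘ p)) (sumBy-zero xs)

count-partition : (p q : A → Bool) (xs : List A) →
                  count (λ x → p x ∧ q x) xs + count (λ x → p x ∧ not (q x)) xs ≡ count p xs
count-partition p q [] = refl
count-partition p q (x ∷ xs) with p x | q x
... | false | _     = count-partition p q xs
... | true  | true  = cong suc (count-partition p q xs)
... | true  | false = trans (+-suc _ _) (cong suc (count-partition p q xs))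

count-any≤sum : {A B : Set} (g : B → A → Bool) (ys : List B) (xs : List A) →
                count (λ x → any (λ y → g y x) ys) xs ≤ sumBy (λ y → count (g y) xs) ys
count-any≤sum g []       xs = ≤-reflexive (sumBy-zero xs)
count-any≤sum {A} {B} g (y ∷ ys) xs = begin
  count (λ x → g y x ∨ anyOf ys x) xs                ≤⟨ sumBy-mono xs (λ x → 𝟙-∨ (g y x) (anyOf ys x)) ⟩
  sumBy (λ x → 𝟙 (g y x) + 𝟙 (anyOf ys x)) xs        ≡⟨ sumBy-+ (λ x → 𝟙 (g y x)) (λ x → 𝟙 (anyOf ys x)) xs ⟩
  count (g y) xs + count (anyOf ys) xs               ≤⟨ +-monoʳ-≤ (count (g y) xs) (count-any≤sum g ys xs) ⟩
  count (g y) xs + sumBy (λ y → count (g y) xs) ys   ∎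
  where
  open ≤-Reasoning
  anyOf : List B → A → Bool
  anyOf ys x = any (λ y → g y x) ys

every : {d : ℕ} → (A → Bool) → Vec A d → Bool
every p []       = true
every p (x ∷ xs) = p x ∧ every p xs

count-every-allVecs : (xs : List A) (d : ℕ) (p : A → Bool) → count (every p) (allVecs xs d) ≡ count p xs ^ d
count-every-allVecs xs zero    p = refl
count-every-allVecs xs (suc d) p = begin
  count (every p) (concatMap (λ x → map (x ∷_) (allVecs xs d)) xs)
    ≡⟨ sumBy-concatMap _ _ xs ⟩
  sumBy (λ x → count (every p) (map (x ∷_) (allVecs xs d))) xs
    ≡⟨ sumBy-cong xs (λ x → trans (sumBy-map _ _ (allVecs xs d)) (count-guarded (p x) (every p) (allVecs xs d))) ⟩
  sumBy (λ x → 𝟙 (p x) * count (every p) (allVecs xs d)) xs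
    ≡⟨ sumBy-*ʳ _ _ xs ⟩
  count p xs * count (every p) (allVecs xs d)
    ≡⟨ cong (count p xs *_) (count-every-allVecs xs d p) ⟩
  count p xs ^ suc d ∎
  where open ≡-Reasoning

length-allVecs : (xs : List A) (d : ℕ) → length (allVecs xs d) ≡ length xs ^ d
length-allVecs xs d = begin
  length (allVecs xs d)                      ≡⟨ length≡count-true (allVecs xs d) ⟩
  count (λ _ → true) (allVecs xs d)          ≡⟨ count-cong (allVecs xs d) (sym ∘ every-true) ⟩
  count (every (λ _ → true)) (allVecs xs d)  ≡⟨ count-every-allVecs xs d (λ _ → true) ⟩
  count (λ _ → true) xs ^ d                  ≡⟨ cong (_^ d) (length≡count-true xs) ⟨
  length xs ^ d                              ∎
  where
  open ≡-Reasoning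
  every-true : {d : ℕ} (v : Vec A d) → every (λ _ → true) v ≡ true
  every-true []       = refl
  every-true (x ∷ v) = every-true v

count-allSubsets-suc : (N : ℕ) (p : Subset (suc N) → Bool) →
                       count p (allSubsets (suc N))
                         ≡ count (p ∘ (true ∷_)) (allSubsets N) + count (p ∘ (false ∷_)) (allSubsets N)
count-allSubsets-suc N p =
  trans (sumBy-concatMap (𝟙 ∘ p) (λ b → map (b ∷_) (allSubsets N)) (true ∷ false ∷ []))
        (cong₂ _+_ (sumBy-map (𝟙 ∘ p) (true ∷_) (allSubsets N))
                   (trans (+-identityʳ _) (sumBy-map (𝟙 ∘ p) (false ∷_) (allSubsets N))))

∑< : ℕ → (ℕ → ℕ) → ℕ
∑< zero    f = 0
∑< (suc K) f = f 0 + ∑< K (f ∘ suc)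

syntax ∑< K (λ i → e) = ∑[ i < K ] e

∑<-cong : ∀ K {f g : ℕ → ℕ} → (∀ i → f i ≡ g i) → ∑< K f ≡ ∑< K g
∑<-cong zero    f≗g = refl
∑<-cong (suc K) f≗g = cong₂ _+_ (f≗g 0) (∑<-cong K (f≗g ∘ suc))

∑<-mono : ∀ K {f g : ℕ → ℕ} → (∀ i → f i ≤ g i) → ∑< K f ≤ ∑< K g
∑<-mono zero    f≤g = z≤n
∑<-mono (suc K) f≤g = +-mono-≤ (f≤g 0) (∑<-mono K (f≤g ∘ suc))

∑<-zero : ∀ K → ∑[ i < K ] 0 ≡ 0
∑<-zero zero    = refl
∑<-zero (suc K) = ∑<-zero K

∑<-indicator : ∀ K j (f : ℕ → ℕ) → j < K → ∑[ i < K ] (𝟙 (j ≡ᵇ i) * f i) ≡ f j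
∑<-indicator (suc K) zero    f _ = trans (cong (f 0 + 0 +_) (∑<-zero K)) (trans (+-identityʳ _) (+-identityʳ _))
∑<-indicator (suc K) (suc j) f (s≤s j<K) = ∑<-indicator K j (f ∘ suc) j<K

sumBy-∑< : (K : ℕ) (h : A → ℕ → ℕ) (xs : List A) →
           sumBy (λ x → ∑< K (h x)) xs ≡ ∑[ i < K ] sumBy (λ x → h x i) xs
sumBy-∑< zero    h xs = sumBy-zero xs
sumBy-∑< (suc K) h xs = trans (sumBy-+ (λ x → h x 0) (λ x → ∑< K (h x ∘ suc)) xs)
                              (cong (sumBy (λ x → h x 0) xs +_) (sumBy-∑< K (λ x → h x ∘ suc) xs))

sumBy-groupBy : (xs : List A) (s g : A → ℕ) (k : ℕ) (f : ℕ → ℕ) → (∀ x → g x ≤ s x) →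
                sumBy (λ x → 𝟙 (s x ≡ᵇ k) * f (g x)) xs
                  ≡ ∑[ i < suc k ] (count (λ x → (s x ≡ᵇ k) ∧ (g x ≡ᵇ i)) xs * f i)
sumBy-groupBy xs s g k f g≤s = begin
  sumBy (λ x → 𝟙 (s x ≡ᵇ k) * f (g x)) xs
    ≡⟨ sumBy-cong xs spread ⟩
  sumBy (λ x → ∑[ i < suc k ] (𝟙 ((s x ≡ᵇ k) ∧ (g x ≡ᵇ i)) * f i)) xs
    ≡⟨ sumBy-∑< (suc k) (λ x i → 𝟙 ((s x ≡ᵇ k) ∧ (g x ≡ᵇ i)) * f i) xs ⟩
  ∑[ i < suc k ] sumBy (λ x → 𝟙 ((s x ≡ᵇ k) ∧ (g x ≡ᵇ i)) * f i) xs
    ≡⟨ ∑<-cong (suc k) (λ i → sumBy-*ʳ (λ x → 𝟙 ((s x ≡ᵇ k) ∧ (g x ≡ᵇ i))) (f i) xs) ⟩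
  ∑[ i < suc k ] (count (λ x → (s x ≡ᵇ k) ∧ (g x ≡ᵇ i)) xs * f i) ∎
  where
  open ≡-Reasoning
  spread : ∀ x → 𝟙 (s x ≡ᵇ k) * f (g x) ≡ ∑[ i < suc k ] (𝟙 ((s x ≡ᵇ k) ∧ (g x ≡ᵇ i)) * f i)
  spread x with s x ≡ᵇ k in sx≡k
  ... | false = sym (∑<-zero (suc k))
  ... | true  = trans (+-identityʳ (f (g x)))
                      (sym (∑<-indicator (suc k) (g x) f (s≤s (≤-trans (g≤s x) (≤-reflexive (≡ᵇ-true⇒≡ (s x) k sx≡k))))))

-- Binomial coefficients and falling factorials

nCk*k!*[n∸k]!≡n! : ∀ {n k} → k ≤ n → (n C k) * (k ! * (n ∸ k) !) ≡ n !
nCk*k!*[n∸k]!≡n! {n} {k} k≤n =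
  trans (cong (_* (k ! * (n ∸ k) !)) (nCk≡n!/k![n-k]! k≤n)) (m/n*n≡m {{k !* (n ∸ k) !≢0}} (k![n∸k]!∣n! k≤n))

nCk>0 : ∀ {n k} → k ≤ n → 0 < (n C k)
nCk>0 {n} {k} k≤n = n≢0⇒n>0 λ nCk≡0 →
  m<n⇒n≢0 (1≤n! n) (trans (sym (nCk*k!*[n∸k]!≡n! k≤n)) (cong (_* (k ! * (n ∸ k) !)) nCk≡0))

nCk≤[1+n]Ck : ∀ n k → (n C k) ≤ (suc n C k)
nCk≤[1+n]Ck n zero    = ≤-refl
nCk≤[1+n]Ck n (suc k) = subst ((n C suc k) ≤_) (nCk+nC[k+1]≡[n+1]C[k+1] n k) (m≤n+m (n C suc k) (n C k))

[1+n]C[1+k]*[1+k]≡[1+n]*nCk : ∀ n k → (suc n C suc k) * suc k ≡ suc n * (n C k)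
[1+n]C[1+k]*[1+k]≡[1+n]*nCk n k with k ≤? n
... | no  k≰n = trans (cong (_* suc k) (k>n⇒nCk≡0 (s≤s (≰⇒> k≰n))))
                      (sym (trans (cong (suc n *_) (k>n⇒nCk≡0 (≰⇒> k≰n))) (*-zeroʳ (suc n))))
... | yes k≤n = *-cancelʳ-≡ _ _ (k ! * (n ∸ k) !) {{k !* (n ∸ k) !≢0}} (begin
  (suc n C suc k) * suc k * (k ! * (n ∸ k) !)    ≡⟨ *-assoc (suc n C suc k) (suc k) _ ⟩
  (suc n C suc k) * (suc k * (k ! * (n ∸ k) !))  ≡⟨ cong ((suc n C suc k) *_) (*-assoc (suc k) (k !) _) ⟨
  (suc n C suc k) * (suc k ! * (n ∸ k) !)        ≡⟨ nCk*k!*[n∸k]!≡n! (s≤s k≤n) ⟩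
  suc n * n !                                    ≡⟨ cong (suc n *_) (nCk*k!*[n∸k]!≡n! k≤n) ⟨
  suc n * ((n C k) * (k ! * (n ∸ k) !))          ≡⟨ *-assoc (suc n) (n C k) _ ⟨
  suc n * (n C k) * (k ! * (n ∸ k) !)            ∎)
  where open ≡-Reasoning

n*[n∸1]P′k≡nP′[1+k] : ∀ n k → n * ((n ∸ 1) P′ k) ≡ (n P′ suc k)
n*[n∸1]P′k≡nP′[1+k] zero    k = cong (_* (0 P′ k)) (sym (0∸n≡0 k))
n*[n∸1]P′k≡nP′[1+k] (suc n) k = sym (nP′k≡n[n∸1P′k∸1] (suc n) (suc k))

k>n⇒nP′k≡0 : ∀ {n k} → n < k → (n P′ k) ≡ 0
k>n⇒nP′k≡0 {n} {suc k} n<1+k with m≤n⇒m<n∨m≡n (≤-pred n<1+k)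
... | inj₁ n<k  = trans (cong ((n ∸ k) *_) (k>n⇒nP′k≡0 n<k)) (*-zeroʳ (n ∸ k))
... | inj₂ refl = cong (_* (n P′ n)) (n∸n≡0 n)

nP′k*[n∸k]!≡n! : ∀ {n k} → k ≤ n → (n P′ k) * (n ∸ k) ! ≡ n !
nP′k*[n∸k]!≡n! {n} {k} k≤n =
  trans (cong (_* (n ∸ k) !) (nP′k≡n!/[n∸k]! k≤n)) (m/n*n≡m {{(n ∸ k) !≢0}} (m≤n⇒m!∣n! (m∸n≤m n k)))

nP′k≡nCk*k! : ∀ n k → (n P′ k) ≡ (n C k) * k !
nP′k≡nCk*k! n k with k ≤? n
... | no  k≰n = trans (k>n⇒nP′k≡0 (≰⇒> k≰n)) (sym (cong (_* k !) (k>n⇒nCk≡0 (≰⇒> k≰n))))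
... | yes k≤n = *-cancelʳ-≡ _ _ ((n ∸ k) !) {{(n ∸ k) !≢0}} (begin
  (n P′ k) * (n ∸ k) !           ≡⟨ nP′k*[n∸k]!≡n! k≤n ⟩
  n !                            ≡⟨ nCk*k!*[n∸k]!≡n! k≤n ⟨
  (n C k) * (k ! * (n ∸ k) !)    ≡⟨ *-assoc (n C k) (k !) _ ⟨
  (n C k) * k ! * (n ∸ k) !      ∎)
  where open ≡-Reasoning

-- confined w u n counts the permutations of an n-set mapping a given u-subset into a given w-subset.
confined : ℕ → ℕ → ℕ → ℕ
confined w u n = (w P′ u) * (n ∸ u) !

confined-zero : ∀ {w u} n → w < u → confined w u n ≡ 0
confined-zero {u = u} n w<u = cong (_* (n ∸ u) !) (k>n⇒nP′k≡0 w<u)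

confined-marked : ∀ w u n → w * confined (w ∸ 1) u n ≡ confined w (suc u) (suc n)
confined-marked w u n = trans (sym (*-assoc w _ _)) (cong (_* (n ∸ u) !) (n*[n∸1]P′k≡nP′[1+k] w u))

confined-suc : ∀ w {u n} → u ≤ n → (suc n ∸ u) * confined w u n ≡ confined w u (suc n)
confined-suc w {u} {n} u≤n = begin
  (suc n ∸ u) * ((w P′ u) * (n ∸ u) !)  ≡⟨ *-leftSwap (suc n ∸ u) (w P′ u) _ ⟩
  (w P′ u) * ((suc n ∸ u) * (n ∸ u) !)  ≡⟨ cong (λ m → (w P′ u) * (m * (n ∸ u) !)) 1+n∸u≡1+[n∸u] ⟩
  (w P′ u) * suc (n ∸ u) !              ≡⟨ cong (λ m → (w P′ u) * m !) 1+n∸u≡1+[n∸u] ⟨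
  (w P′ u) * (suc n ∸ u) !              ∎
  where
  open ≡-Reasoning
  1+n∸u≡1+[n∸u] : suc n ∸ u ≡ suc (n ∸ u)
  1+n∸u≡1+[n∸u] = +-∸-assoc 1 u≤n

confined-unmarked : ∀ w r n u → w + r ≡ suc n → u ≤ n →
                    w * confined (w ∸ 1) u n + r * confined w u n ≡ confined w u (suc n)
confined-unmarked w r n u w+r≡1+n u≤n = begin
  w * confined (w ∸ 1) u n + r * confined w u n
    ≡⟨ cong (_+ r * confined w u n) (trans (confined-marked w u n) (*-assoc (w ∸ u) _ _)) ⟩
  (w ∸ u) * confined w u n + r * confined w u n
    ≡⟨ *-distribʳ-+ (confined w u n) (w ∸ u) r ⟨
  (w ∸ u + r) * confined w u n
    ≡⟨ choices ⟩
  (suc n ∸ u) * confined w u n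
    ≡⟨ confined-suc w u≤n ⟩
  confined w u (suc n) ∎
  where
  open ≡-Reasoning
  choices : (w ∸ u + r) * confined w u n ≡ (suc n ∸ u) * confined w u n
  choices with u ≤? w
  ... | yes u≤w = cong (_* confined w u n) (trans (sym (+-∸-comm r u≤w)) (cong (_∸ u) w+r≡1+n))
  ... | no  u≰w = trans (cong ((w ∸ u + r) *_) none)
                        (trans (*-zeroʳ (w ∸ u + r)) (sym (trans (cong ((suc n ∸ u) *_) none) (*-zeroʳ (suc n ∸ u)))))
    where
    none : confined w u n ≡ 0
    none = confined-zero n (≰⇒> u≰w)

-- supersets n i w is the number of w-subsets of an n-set containing a given i-subset,
-- that is (n ∸ i) C (w ∸ i) when i ≤ n and i ≤ w, and 0 otherwise.
supersets : ℕ → ℕ → ℕ → ℕ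
supersets n       zero    w       = n C w
supersets zero    (suc i) w       = 0
supersets (suc n) (suc i) zero    = 0
supersets (suc n) (suc i) (suc w) = supersets n i w

supersets-suc-zero : ∀ n i → supersets (suc n) i 0 ≡ supersets n i 0
supersets-suc-zero n       zero    = refl
supersets-suc-zero zero    (suc i) = refl
supersets-suc-zero (suc n) (suc i) = refl

supersets-pascal : ∀ n i w → i ≤ n → supersets (suc n) i (suc w) ≡ supersets n i w + supersets n i (suc w)
supersets-pascal n       zero    w       _         = sym (nCk+nC[k+1]≡[n+1]C[k+1] n w)
supersets-pascal (suc n) (suc i) zero    (s≤s i≤n) = supersets-suc-zero n i
supersets-pascal (suc n) (suc i) (suc w) (s≤s i≤n) = supersets-pascal n i w i≤n

supersets*nCi≡nCw*wCi : ∀ n i w → i ≤ n → supersets n i w * (n C i) ≡ (n C w) * (w C i)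
supersets*nCi≡nCw*wCi n       zero    w       _         = refl
supersets*nCi≡nCw*wCi (suc n) (suc i) zero    _         = sym (*-zeroʳ (suc n C 0))
supersets*nCi≡nCw*wCi (suc n) (suc i) (suc w) (s≤s i≤n) = *-cancelʳ-≡ _ _ (suc i) (begin
  supersets n i w * (suc n C suc i) * suc i     ≡⟨ *-assoc (supersets n i w) _ _ ⟩
  supersets n i w * ((suc n C suc i) * suc i)   ≡⟨ cong (supersets n i w *_) ([1+n]C[1+k]*[1+k]≡[1+n]*nCk n i) ⟩
  supersets n i w * (suc n * (n C i))           ≡⟨ *-leftSwap (supersets n i w) (suc n) (n C i) ⟩
  suc n * (supersets n i w * (n C i))           ≡⟨ cong (suc n *_) (supersets*nCi≡nCw*wCi n i w i≤n) ⟩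
  suc n * ((n C w) * (w C i))                   ≡⟨ *-assoc (suc n) (n C w) (w C i) ⟨
  suc n * (n C w) * (w C i)                     ≡⟨ cong (_* (w C i)) ([1+n]C[1+k]*[1+k]≡[1+n]*nCk n w) ⟨
  (suc n C suc w) * suc w * (w C i)             ≡⟨ *-assoc (suc n C suc w) (suc w) (w C i) ⟩
  (suc n C suc w) * (suc w * (w C i))           ≡⟨ cong ((suc n C suc w) *_) ([1+n]C[1+k]*[1+k]≡[1+n]*nCk w i) ⟨
  (suc n C suc w) * ((suc w C suc i) * suc i)   ≡⟨ *-assoc (suc n C suc w) _ (suc i) ⟨
  (suc n C suc w) * (suc w C suc i) * suc i     ∎)
  where open ≡-Reasoning

-- Distinct sequences and permutations

_∉ᵇ_ : {N : ℕ} → Fin N → List (Fin N) → Bool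
x ∉ᵇ []       = true
x ∉ᵇ (y ∷ ys) = not (does (x ≟ y)) ∧ x ∉ᵇ ys

distinct : {N : ℕ} → List (Fin N) → Bool
distinct []       = true
distinct (x ∷ xs) = x ∉ᵇ xs ∧ distinct xs

disjoint : {N : ℕ} → List (Fin N) → List (Fin N) → Bool
disjoint []       ys = true
disjoint (x ∷ xs) ys = x ∉ᵇ ys ∧ disjoint xs ys

distinctOutside : {N : ℕ} → List (Fin N) → List (Fin N) → Bool
distinctOutside used []       = true
distinctOutside used (x ∷ xs) = x ∉ᵇ used ∧ distinctOutside (x ∷ used) xs

disjoint-∷ʳ : {N : ℕ} (x : Fin N) (xs ys : List (Fin N)) → disjoint xs (x ∷ ys) ≡ x ∉ᵇ xs ∧ disjoint xs ys
disjoint-∷ʳ x []       ys = refl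
disjoint-∷ʳ x (z ∷ zs) ys = begin
  (not (does (z ≟ x)) ∧ z ∉ᵇ ys) ∧ disjoint zs (x ∷ ys)
    ≡⟨ cong₂ (λ b c → (not b ∧ z ∉ᵇ ys) ∧ c) (does-⇔ (mk⇔ sym sym) (z ≟ x) (x ≟ z)) (disjoint-∷ʳ x zs ys) ⟩
  (not (does (x ≟ z)) ∧ z ∉ᵇ ys) ∧ (x ∉ᵇ zs ∧ disjoint zs ys)
    ≡⟨ ∧-interchange (not (does (x ≟ z))) (z ∉ᵇ ys) (x ∉ᵇ zs) (disjoint zs ys) ⟩
  (not (does (x ≟ z)) ∧ x ∉ᵇ zs) ∧ (z ∉ᵇ ys ∧ disjoint zs ys) ∎
  where open ≡-Reasoning

distinctOutside≡distinct∧disjoint : {N : ℕ} (used xs : List (Fin N)) →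
                                    distinctOutside used xs ≡ distinct xs ∧ disjoint xs used
distinctOutside≡distinct∧disjoint used []       = refl
distinctOutside≡distinct∧disjoint used (x ∷ xs) = begin
  x ∉ᵇ used ∧ distinctOutside (x ∷ used) xs
    ≡⟨ cong (x ∉ᵇ used ∧_) (distinctOutside≡distinct∧disjoint (x ∷ used) xs) ⟩
  x ∉ᵇ used ∧ (distinct xs ∧ disjoint xs (x ∷ used))
    ≡⟨ cong (λ b → x ∉ᵇ used ∧ (distinct xs ∧ b)) (disjoint-∷ʳ x xs used) ⟩
  x ∉ᵇ used ∧ (distinct xs ∧ (x ∉ᵇ xs ∧ disjoint xs used))
    ≡⟨ shuffle (x ∉ᵇ used) (distinct xs) (x ∉ᵇ xs) (disjoint xs used) ⟩
  (x ∉ᵇ xs ∧ distinct xs) ∧ (x ∉ᵇ used ∧ disjoint xs used) ∎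
  where
  open ≡-Reasoning
  shuffle : ∀ a b c d → a ∧ (b ∧ (c ∧ d)) ≡ (c ∧ b) ∧ (a ∧ d)
  shuffle a true  true  d = refl
  shuffle a true  false d = ∧-zeroʳ a
  shuffle a false c     d = trans (∧-zeroʳ a) (cong (_∧ (a ∧ d)) (sym (∧-zeroʳ c)))

does-unique?≡distinct : {N : ℕ} (xs : List (Fin N)) → does (UniqueDec.unique? (_≟_ {N}) xs) ≡ distinct xs
does-unique?≡distinct []       = refl
does-unique?≡distinct (x ∷ xs) = cong₂ _∧_ (does-all?≡∉ᵇ xs) (does-unique?≡distinct xs)
  where
  does-all?≡∉ᵇ : ∀ ys → does (all? (λ y → ¬? (x ≟ y)) ys) ≡ x ∉ᵇ ys
  does-all?≡∉ᵇ []       = refl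
  does-all?≡∉ᵇ (y ∷ ys) = cong (not (does (x ≟ y)) ∧_) (does-all?≡∉ᵇ ys)

does-IsPerm?≡distinctOutside : {N : ℕ} (v : Vec (Fin N) N) → does (IsPerm? v) ≡ distinctOutside [] (toList v)
does-IsPerm?≡distinctOutside v = begin
  does (IsPerm? v)                               ≡⟨ does-unique?≡distinct (toList v) ⟩
  distinct (toList v)                            ≡⟨ ∧-identityʳ _ ⟨
  distinct (toList v) ∧ true                     ≡⟨ cong (distinct (toList v) ∧_) (disjoint-[] (toList v)) ⟨
  distinct (toList v) ∧ disjoint (toList v) []   ≡⟨ distinctOutside≡distinct∧disjoint [] (toList v) ⟨
  distinctOutside [] (toList v)                  ∎
  where
  open ≡-Reasoning
  disjoint-[] : ∀ xs → disjoint xs [] ≡ true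
  disjoint-[] []       = refl
  disjoint-[] (x ∷ xs) = disjoint-[] xs

sumBy-allFin-suc : {n : ℕ} (f : Fin (suc n) → ℕ) → sumBy f (allFin (suc n)) ≡ f zero + sumBy (f ∘ suc) (allFin n)
sumBy-allFin-suc {n} f =
  cong (f zero +_) (trans (cong (sumBy f) (sym (map-tabulate id suc))) (sumBy-map f suc (allFin n)))

count-allFin-remove : {n : ℕ} (g : Fin n → Bool) (x : Fin n) →
                      count (λ y → not (does (y ≟ x)) ∧ g y) (allFin n) + 𝟙 (g x) ≡ count g (allFin n)
count-allFin-remove {suc n} g zero = begin
  count (λ y → not (does (y ≟ zero)) ∧ g y) (allFin (suc n)) + 𝟙 (g zero)
    ≡⟨ cong (_+ 𝟙 (g zero)) (sumBy-allFin-suc (λ y → 𝟙 (not (does (y ≟ zero)) ∧ g y))) ⟩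
  count (g ∘ suc) (allFin n) + 𝟙 (g zero)
    ≡⟨ +-comm (count (g ∘ suc) (allFin n)) (𝟙 (g zero)) ⟩
  𝟙 (g zero) + count (g ∘ suc) (allFin n)
    ≡⟨ sumBy-allFin-suc (𝟙 ∘ g) ⟨
  count g (allFin (suc n)) ∎
  where open ≡-Reasoning
count-allFin-remove {suc n} g (suc x) = begin
  count (λ y → not (does (y ≟ suc x)) ∧ g y) (allFin (suc n)) + 𝟙 (g (suc x))
    ≡⟨ cong (_+ 𝟙 (g (suc x))) (sumBy-allFin-suc (λ y → 𝟙 (not (does (y ≟ suc x)) ∧ g y))) ⟩
  𝟙 (g zero) + count (λ y → not (does (y ≟ x)) ∧ g (suc y)) (allFin n) + 𝟙 (g (suc x))
    ≡⟨ +-assoc (𝟙 (g zero)) _ _ ⟩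
  𝟙 (g zero) + (count (λ y → not (does (y ≟ x)) ∧ g (suc y)) (allFin n) + 𝟙 (g (suc x)))
    ≡⟨ cong (𝟙 (g zero) +_) (count-allFin-remove (g ∘ suc) x) ⟩
  𝟙 (g zero) + count (g ∘ suc) (allFin n)
    ≡⟨ sumBy-allFin-suc (𝟙 ∘ g) ⟨
  count g (allFin (suc n)) ∎
  where open ≡-Reasoning

count-lookup-allFin : {n : ℕ} (U : Subset n) → count (lookup U) (allFin n) ≡ ∣ U ∣
count-lookup-allFin []          = refl
count-lookup-allFin (true ∷ U)  = trans (sumBy-allFin-suc (𝟙 ∘ lookup (true ∷ U))) (cong suc (count-lookup-allFin U))
count-lookup-allFin (false ∷ U) = trans (sumBy-allFin-suc (𝟙 ∘ lookup (false ∷ U))) (count-lookup-allFin U)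

count-true-allFin : (n : ℕ) → count (λ (_ : Fin n) → true) (allFin n) ≡ n
count-true-allFin n = trans (sym (length≡count-true (allFin n))) (length-tabulate id)

mapsInto : {N n : ℕ} → (Fin N → Bool) → Subset n → Vec (Fin N) n → Bool
mapsInto W []      []       = true
mapsInto W (b ∷ U) (x ∷ xs) = (not b ∨ W x) ∧ mapsInto W U xs

-- Permutations are counted as distinct sequences built one entry at a time: used holds the entries
-- chosen so far, and the invariant free used ≡ n says exactly as many values remain as positions.
module DistinctSequences {N : ℕ} (W : Fin N → Bool) where

  sequences : List (Fin N) → (n : ℕ) → Subset n → ℕ
  sequences used n U = count (λ v → distinctOutside used (toList v) ∧ mapsInto W U v) (allVecs (allFin N) n)

  free : List (Fin N) → ℕ
  free used = count (_∉ᵇ used) (allFin N)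

  freeInW : List (Fin N) → ℕ
  freeInW used = count (λ y → y ∉ᵇ used ∧ W y) (allFin N)

  sequences-∷ : ∀ used n b (U : Subset n) →
                sequences used (suc n) (b ∷ U)
                  ≡ sumBy (λ x → 𝟙 (x ∉ᵇ used ∧ (not b ∨ W x)) * sequences (x ∷ used) n U) (allFin N)
  sequences-∷ used n b U =
    trans (sumBy-concatMap _ _ (allFin N)) (sumBy-cong (allFin N) λ x →
      trans (sumBy-map _ _ (allVecs (allFin N) n))
            (trans (count-cong (allVecs (allFin N) n) (λ v →
                      ∧-interchange (x ∉ᵇ used) (distinctOutside (x ∷ used) (toList v)) (not b ∨ W x) (mapsInto W U v)))
                   (count-guarded (x ∉ᵇ used ∧ (not b ∨ W x))
                                  (λ v → distinctOutside (x ∷ used) (toList v) ∧ mapsInto W U v)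
                                  (allVecs (allFin N) n))))

  free-∷ : ∀ {x} used → x ∉ᵇ used ≡ true → free (x ∷ used) + 1 ≡ free used
  free-∷ {x} used fresh =
    trans (cong (λ b → free (x ∷ used) + 𝟙 b) (sym fresh)) (count-allFin-remove (_∉ᵇ used) x)

  freeInW-∷ : ∀ {x} used → x ∉ᵇ used ≡ true → freeInW (x ∷ used) ≡ freeInW used ∸ 𝟙 (W x)
  freeInW-∷ {x} used fresh = sym (trans (cong (_∸ 𝟙 (W x)) (sym removed)) (m+n∸n≡m _ (𝟙 (W x))))
    where
    removed : freeInW (x ∷ used) + 𝟙 (W x) ≡ freeInW used
    removed = trans (cong₂ _+_ (count-cong (allFin N) (λ y → ∧-assoc (not (does (y ≟ x))) (y ∉ᵇ used) (W y)))
                               (cong (λ b → 𝟙 (b ∧ W x)) (sym fresh)))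
                    (count-allFin-remove (λ y → y ∉ᵇ used ∧ W y) x)

  sequences≡confined : ∀ n used (U : Subset n) → free used ≡ n →
                       sequences used n U ≡ confined (freeInW used) (∣ U ∣) n

  sequences-after : ∀ n used {x b} (U : Subset n) → x ∉ᵇ used ≡ true → W x ≡ b → free used ≡ suc n →
                    sequences (x ∷ used) n U ≡ confined (freeInW used ∸ 𝟙 b) (∣ U ∣) n
  sequences-after n used {x} U fresh refl free≡ =
    trans (sequences≡confined n (x ∷ used) U (suc-injective (trans (+-comm 1 _) (trans (free-∷ used fresh) free≡))))
          (cong (λ w → confined w (∣ U ∣) n) (freeInW-∷ used fresh))

  sequences≡confined zero    used []          _     = refl
  sequences≡confined (suc n) used (true ∷ U)  free≡ = begin
    sequences used (suc n) (true ∷ U)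
      ≡⟨ sequences-∷ used n true U ⟩
    sumBy (λ x → 𝟙 (x ∉ᵇ used ∧ W x) * sequences (x ∷ used) n U) (allFin N)
      ≡⟨ sumBy-cong (allFin N) placeInW ⟩
    sumBy (λ x → 𝟙 (x ∉ᵇ used ∧ W x) * confined (freeInW used ∸ 1) (∣ U ∣) n) (allFin N)
      ≡⟨ sumBy-*ʳ _ _ (allFin N) ⟩
    freeInW used * confined (freeInW used ∸ 1) (∣ U ∣) n
      ≡⟨ confined-marked (freeInW used) (∣ U ∣) n ⟩
    confined (freeInW used) (∣ true ∷ U ∣) (suc n) ∎
    where
    open ≡-Reasoning
    placeInW : ∀ x → 𝟙 (x ∉ᵇ used ∧ W x) * sequences (x ∷ used) n U
                     ≡ 𝟙 (x ∉ᵇ used ∧ W x) * confined (freeInW used ∸ 1) (∣ U ∣) n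
    placeInW x with x ∉ᵇ used in fresh | W x in inW
    ... | false | _     = refl
    ... | true  | false = refl
    ... | true  | true  = cong (1 *_) (sequences-after n used U fresh inW free≡)
  sequences≡confined (suc n) used (false ∷ U) free≡ = begin
    sequences used (suc n) (false ∷ U)
      ≡⟨ sequences-∷ used n false U ⟩
    sumBy (λ x → 𝟙 (x ∉ᵇ used ∧ true) * sequences (x ∷ used) n U) (allFin N)
      ≡⟨ sumBy-cong (allFin N) placeAnywhere ⟩
    sumBy (λ x → 𝟙 (x ∉ᵇ used ∧ W x) * confined (freeInW used ∸ 1) (∣ U ∣) n
               + 𝟙 (x ∉ᵇ used ∧ not (W x)) * confined (freeInW used) (∣ U ∣) n) (allFin N)
      ≡⟨ trans (sumBy-+ _ _ (allFin N)) (cong₂ _+_ (sumBy-*ʳ _ _ (allFin N)) (sumBy-*ʳ _ _ (allFin N))) ⟩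
    freeInW used * confined (freeInW used ∸ 1) (∣ U ∣) n
      + count (λ x → x ∉ᵇ used ∧ not (W x)) (allFin N) * confined (freeInW used) (∣ U ∣) n
      ≡⟨ confined-unmarked (freeInW used) _ n (∣ U ∣) (trans (count-partition (_∉ᵇ used) W (allFin N)) free≡) (∣p∣≤n U) ⟩
    confined (freeInW used) (∣ false ∷ U ∣) (suc n) ∎
    where
    open ≡-Reasoning
    placeAnywhere : ∀ x → 𝟙 (x ∉ᵇ used ∧ true) * sequences (x ∷ used) n U
                          ≡ 𝟙 (x ∉ᵇ used ∧ W x) * confined (freeInW used ∸ 1) (∣ U ∣) n
                            + 𝟙 (x ∉ᵇ used ∧ not (W x)) * confined (freeInW used) (∣ U ∣) n
    placeAnywhere x with x ∉ᵇ used in fresh | W x in inW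
    ... | false | _     = refl
    ... | true  | true  = trans (cong (1 *_) (sequences-after n used U fresh inW free≡)) (sym (+-identityʳ _))
    ... | true  | false = cong (1 *_) (sequences-after n used U fresh inW free≡)

count-mapsInto-allPerms : {N : ℕ} (W : Fin N → Bool) (U : Subset N) →
                          count (mapsInto W U) (allPerms N) ≡ confined (count W (allFin N)) (∣ U ∣) N
count-mapsInto-allPerms {N} W U = begin
  count (mapsInto W U) (allPerms N)
    ≡⟨ sumBy-filter IsPerm? (𝟙 ∘ mapsInto W U) (allVecs (allFin N) N) ⟩
  sumBy (λ v → 𝟙 (does (IsPerm? v)) * 𝟙 (mapsInto W U v)) (allVecs (allFin N) N)
    ≡⟨ sumBy-cong (allVecs (allFin N) N) (λ v →
         trans (cong (λ b → 𝟙 b * 𝟙 (mapsInto W U v)) (does-IsPerm?≡distinctOutside v))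
               (sym (𝟙-∧ (distinctOutside [] (toList v)) (mapsInto W U v)))) ⟩
  sequences [] N U
    ≡⟨ sequences≡confined N [] U (count-true-allFin N) ⟩
  confined (count W (allFin N)) (∣ U ∣) N ∎
  where
  open ≡-Reasoning
  open DistinctSequences W

length-allPerms : (N : ℕ) → length (allPerms N) ≡ N !
length-allPerms N = begin
  length (allPerms N)                                          ≡⟨ length≡count-true (allPerms N) ⟩
  count (λ _ → true) (allPerms N)                              ≡⟨ count-cong (allPerms N) (sym ∘ mapsInto-⊥) ⟩
  count (mapsInto (λ _ → true) ⊥) (allPerms N)                 ≡⟨ count-mapsInto-allPerms {N} (λ _ → true) ⊥ ⟩
  confined everything (∣ ⊥ {n = N} ∣) N                        ≡⟨ cong (λ u → confined everything u N) (∣⊥∣≡0 N) ⟩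
  1 * N !                                                      ≡⟨ *-identityˡ (N !) ⟩
  N !                                                          ∎
  where
  open ≡-Reasoning
  everything : ℕ
  everything = count (λ (_ : Fin N) → true) (allFin N)
  mapsInto-⊥ : {n : ℕ} (v : Vec (Fin N) n) → mapsInto (λ _ → true) ⊥ v ≡ true
  mapsInto-⊥ []      = refl
  mapsInto-⊥ (x ∷ v) = mapsInto-⊥ v

-- Counting subsets

count-size≡nCk : (N w : ℕ) → count (λ W → ∣ W ∣ ≡ᵇ w) (allSubsets N) ≡ (N C w)
count-size≡nCk zero    zero    = refl
count-size≡nCk zero    (suc w) = sym (k>n⇒nCk≡0 {0} {suc w} (s≤s z≤n))
count-size≡nCk (suc N) zero    =
  trans (count-allSubsets-suc N (λ W → ∣ W ∣ ≡ᵇ 0))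
        (trans (cong (_+ count (λ W → ∣ W ∣ ≡ᵇ 0) (allSubsets N)) (sumBy-zero (allSubsets N)))
               (count-size≡nCk N 0))
count-size≡nCk (suc N) (suc w) =
  trans (count-allSubsets-suc N (λ W → ∣ W ∣ ≡ᵇ suc w))
        (trans (cong₂ _+_ (count-size≡nCk N w) (count-size≡nCk N (suc w))) (nCk+nC[k+1]≡[n+1]C[k+1] N w))

containsBelow : {n : ℕ} → ℕ → Subset n → Subset n → Bool
containsBelow zero    _       _       = true
containsBelow (suc D) []      []      = true
containsBelow (suc D) (u ∷ U) (w ∷ W) = (not u ∨ w) ∧ containsBelow D U W

sizeBelow : {n : ℕ} → ℕ → Subset n → ℕ
sizeBelow zero    _       = 0
sizeBelow (suc D) []      = 0
sizeBelow (suc D) (u ∷ U) = 𝟙 u + sizeBelow D U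

sizeBelow≤n : {n : ℕ} (D : ℕ) (U : Subset n) → sizeBelow D U ≤ n
sizeBelow≤n zero    U           = z≤n
sizeBelow≤n (suc D) []          = z≤n
sizeBelow≤n (suc D) (true ∷ U)  = s≤s (sizeBelow≤n D U)
sizeBelow≤n (suc D) (false ∷ U) = m≤n⇒m≤1+n (sizeBelow≤n D U)

sizeBelow≤size : {n : ℕ} (D : ℕ) (U : Subset n) → sizeBelow D U ≤ ∣ U ∣
sizeBelow≤size zero    U           = z≤n
sizeBelow≤size (suc D) []          = z≤n
sizeBelow≤size (suc D) (true ∷ U)  = s≤s (sizeBelow≤size D U)
sizeBelow≤size (suc D) (false ∷ U) = sizeBelow≤size D U

count-containsBelow : ∀ N D (U : Subset N) w →
                      count (λ W → (∣ W ∣ ≡ᵇ w) ∧ containsBelow D U W) (allSubsets N) ≡ supersets N (sizeBelow D U) w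
count-containsBelow N zero U w =
  trans (count-cong (allSubsets N) (λ W → ∧-identityʳ (∣ W ∣ ≡ᵇ w))) (count-size≡nCk N w)
count-containsBelow zero (suc D) [] zero    = refl
count-containsBelow zero (suc D) [] (suc w) = sym (k>n⇒nCk≡0 {0} {suc w} (s≤s z≤n))
count-containsBelow (suc N) (suc D) (true ∷ U) zero =
  trans (count-allSubsets-suc N _) (cong₂ _+_ (sumBy-zero (allSubsets N)) (count-∧-false _ (allSubsets N)))
count-containsBelow (suc N) (suc D) (true ∷ U) (suc w) =
  trans (count-allSubsets-suc N _)
        (trans (cong₂ _+_ (count-containsBelow N D U w) (count-∧-false _ (allSubsets N))) (+-identityʳ _))
count-containsBelow (suc N) (suc D) (false ∷ U) zero =
  trans (count-allSubsets-suc N _)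
        (trans (cong₂ _+_ (sumBy-zero (allSubsets N)) (count-containsBelow N D U 0))
               (sym (supersets-suc-zero N (sizeBelow D U))))
count-containsBelow (suc N) (suc D) (false ∷ U) (suc w) =
  trans (count-allSubsets-suc N _)
        (trans (cong₂ _+_ (count-containsBelow N D U w) (count-containsBelow N D U (suc w)))
               (sym (supersets-pascal N (sizeBelow D U) w (sizeBelow≤n D U))))

count-sizeBelow≤ : ∀ N D k i →
                   count (λ U → (∣ U ∣ ≡ᵇ k) ∧ (sizeBelow D U ≡ᵇ i)) (allSubsets N) ≤ (D C i) * ((N ∸ D) C (k ∸ i))
count-sizeBelow≤ N zero k zero = ≤-reflexive (begin
  count (λ U → (∣ U ∣ ≡ᵇ k) ∧ true) (allSubsets N)  ≡⟨ count-cong (allSubsets N) (λ U → ∧-identityʳ (∣ U ∣ ≡ᵇ k)) ⟩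
  count (λ U → ∣ U ∣ ≡ᵇ k) (allSubsets N)           ≡⟨ count-size≡nCk N k ⟩
  N C k                                            ≡⟨ +-identityʳ (N C k) ⟨
  1 * (N C k)                                      ∎)
  where open ≡-Reasoning
count-sizeBelow≤ N zero k (suc i) = ≤-trans (≤-reflexive (count-∧-false _ (allSubsets N))) z≤n
count-sizeBelow≤ zero (suc D) zero    zero    = ≤-refl
count-sizeBelow≤ zero (suc D) zero    (suc i) = z≤n
count-sizeBelow≤ zero (suc D) (suc k) i       = z≤n
count-sizeBelow≤ (suc N) (suc D) zero i = begin
  count (λ U → (∣ U ∣ ≡ᵇ 0) ∧ (sizeBelow (suc D) U ≡ᵇ i)) (allSubsets (suc N))
    ≡⟨ count-allSubsets-suc N (λ U → (∣ U ∣ ≡ᵇ 0) ∧ (sizeBelow (suc D) U ≡ᵇ i)) ⟩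
  sumBy (λ _ → 0) (allSubsets N) + count (λ U → (∣ U ∣ ≡ᵇ 0) ∧ (sizeBelow D U ≡ᵇ i)) (allSubsets N)
    ≡⟨ cong (_+ count (λ U → (∣ U ∣ ≡ᵇ 0) ∧ (sizeBelow D U ≡ᵇ i)) (allSubsets N)) (sumBy-zero (allSubsets N)) ⟩
  count (λ U → (∣ U ∣ ≡ᵇ 0) ∧ (sizeBelow D U ≡ᵇ i)) (allSubsets N)
    ≤⟨ count-sizeBelow≤ N D zero i ⟩
  (D C i) * ((N ∸ D) C (0 ∸ i))
    ≤⟨ *-monoˡ-≤ ((N ∸ D) C (0 ∸ i)) (nCk≤[1+n]Ck D i) ⟩
  (suc D C i) * ((N ∸ D) C (0 ∸ i)) ∎
  where open ≤-Reasoning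
count-sizeBelow≤ (suc N) (suc D) (suc k) zero = begin
  count (λ U → (∣ U ∣ ≡ᵇ suc k) ∧ (sizeBelow (suc D) U ≡ᵇ 0)) (allSubsets (suc N))
    ≡⟨ count-allSubsets-suc N (λ U → (∣ U ∣ ≡ᵇ suc k) ∧ (sizeBelow (suc D) U ≡ᵇ 0)) ⟩
  count (λ U → (∣ U ∣ ≡ᵇ k) ∧ false) (allSubsets N) + count (λ U → (∣ U ∣ ≡ᵇ suc k) ∧ (sizeBelow D U ≡ᵇ 0)) (allSubsets N)
    ≡⟨ cong (_+ count (λ U → (∣ U ∣ ≡ᵇ suc k) ∧ (sizeBelow D U ≡ᵇ 0)) (allSubsets N))
            (count-∧-false (λ U → ∣ U ∣ ≡ᵇ k) (allSubsets N)) ⟩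
  count (λ U → (∣ U ∣ ≡ᵇ suc k) ∧ (sizeBelow D U ≡ᵇ 0)) (allSubsets N)
    ≤⟨ count-sizeBelow≤ N D (suc k) zero ⟩
  (D C 0) * ((N ∸ D) C suc k) ∎
  where open ≤-Reasoning
count-sizeBelow≤ (suc N) (suc D) (suc k) (suc i) = begin
  count (λ U → (∣ U ∣ ≡ᵇ suc k) ∧ (sizeBelow (suc D) U ≡ᵇ suc i)) (allSubsets (suc N))
    ≡⟨ count-allSubsets-suc N (λ U → (∣ U ∣ ≡ᵇ suc k) ∧ (sizeBelow (suc D) U ≡ᵇ suc i)) ⟩
  count (λ U → (∣ U ∣ ≡ᵇ k) ∧ (sizeBelow D U ≡ᵇ i)) (allSubsets N)
    + count (λ U → (∣ U ∣ ≡ᵇ suc k) ∧ (sizeBelow D U ≡ᵇ suc i)) (allSubsets N)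
    ≤⟨ +-mono-≤ (count-sizeBelow≤ N D k i) (count-sizeBelow≤ N D (suc k) (suc i)) ⟩
  (D C i) * ((N ∸ D) C (k ∸ i)) + (D C suc i) * ((N ∸ D) C (k ∸ i))
    ≡⟨ *-distribʳ-+ ((N ∸ D) C (k ∸ i)) (D C i) (D C suc i) ⟨
  ((D C i) + (D C suc i)) * ((N ∸ D) C (k ∸ i))
    ≡⟨ cong (_* ((N ∸ D) C (k ∸ i))) (nCk+nC[k+1]≡[n+1]C[k+1] D i) ⟩
  (suc D C suc i) * ((N ∸ D) C (k ∸ i)) ∎
  where open ≤-Reasoning

admissible : {N : ℕ} (D k w : ℕ) → Subset N → Subset N → Bool
admissible D k w U W = (∣ U ∣ ≡ᵇ k) ∧ ((∣ W ∣ ≡ᵇ w) ∧ containsBelow D U W)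

admissiblePairs : (N D k w : ℕ) → ℕ
admissiblePairs N D k w = sumBy (λ U → count (admissible D k w U) (allSubsets N)) (allSubsets N)

admissiblePairs≤ : ∀ N D k w →
                   admissiblePairs N D k w ≤ ∑[ i < suc k ] ((D C i) * ((N ∸ D) C (k ∸ i)) * supersets N i w)
admissiblePairs≤ N D k w = begin
  admissiblePairs N D k w
    ≡⟨ sumBy-cong (allSubsets N) (λ U → count-guarded (∣ U ∣ ≡ᵇ k) _ (allSubsets N)) ⟩
  sumBy (λ U → 𝟙 (∣ U ∣ ≡ᵇ k) * count (λ W → (∣ W ∣ ≡ᵇ w) ∧ containsBelow D U W) (allSubsets N)) (allSubsets N)
    ≡⟨ sumBy-cong (allSubsets N) (λ U → cong (𝟙 (∣ U ∣ ≡ᵇ k) *_) (count-containsBelow N D U w)) ⟩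
  sumBy (λ U → 𝟙 (∣ U ∣ ≡ᵇ k) * supersets N (sizeBelow D U) w) (allSubsets N)
    ≡⟨ sumBy-groupBy (allSubsets N) ∣_∣ (sizeBelow D) k (λ i → supersets N i w) (sizeBelow≤size D) ⟩
  ∑[ i < suc k ] (count (λ U → (∣ U ∣ ≡ᵇ k) ∧ (sizeBelow D U ≡ᵇ i)) (allSubsets N) * supersets N i w)
    ≤⟨ ∑<-mono (suc k) (λ i → *-monoˡ-≤ (supersets N i w) (count-sizeBelow≤ N D k i)) ⟩
  ∑[ i < suc k ] ((D C i) * ((N ∸ D) C (k ∸ i)) * supersets N i w) ∎
  where open ≤-Reasoning

-- Witnesses of the bad event

any-intro : (p : A → Bool) {x : A} {xs : List A} → x ∈ xs → p x ≡ true → any p xs ≡ true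
any-intro p x∈xs px = Equivalence.to T-≡ (any⁺ p (lose x∈xs (Equivalence.from T-≡ px)))

any-elim : (p : A → Bool) (xs : List A) → any p xs ≡ true → Σ[ x ∈ A ] p x ≡ true
any-elim p xs any≡true with satisfied (any⁻ p xs (Equivalence.from T-≡ any≡true))
... | x , px = x , Equivalence.to T-≡ px

∈-allSubsets : {N : ℕ} (U : Subset N) → U ∈ allSubsets N
∈-allSubsets []                  = here refl
∈-allSubsets {suc N} (true ∷ U)  = ∈-++⁺ˡ (∈-map⁺ (true ∷_) (∈-allSubsets U))
∈-allSubsets {suc N} (false ∷ U) =
  ∈-++⁺ʳ (map (true ∷_) (allSubsets N)) (∈-++⁺ˡ (∈-map⁺ (false ∷_) (∈-allSubsets U)))

anyFin-intro : {n : ℕ} (p : Fin n → Bool) (x : Fin n) → p x ≡ true → anyFin p ≡ true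
anyFin-intro p x = any-intro p (∈-allFin x)

nbhd-diagonal : ∀ {N d} D (πs : Vec (Vec (Fin N) N) d) (U : Subset N) i →
                lookup U i ≡ true → toℕ i < D → lookup (nbhd D πs U) i ≡ true
nbhd-diagonal D πs U i i∈U i<D =
  trans (lookup∘tabulate (λ j → anyFin (λ l → lookup U l ∧ edge D πs l j)) i)
        (anyFin-intro (λ l → lookup U l ∧ edge D πs l i) i (cong₂ _∧_ i∈U diagonalEdge))
  where
  permutationEdge : Bool
  permutationEdge = anyFin (λ t → does (lookup (lookup πs t) i ≟ i))
  diagonalEdge : edge D πs i i ≡ true
  diagonalEdge = trans (cong (permutationEdge ∨_) (cong₂ _∧_ (dec-true (i ≟ i) refl) (Equivalence.to T-≡ (<⇒<ᵇ i<D))))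
                       (∨-zeroʳ permutationEdge)

nbhd-image : ∀ {N d} D (πs : Vec (Vec (Fin N) N) d) (U : Subset N) t i →
             lookup U i ≡ true → lookup (nbhd D πs U) (lookup (lookup πs t) i) ≡ true
nbhd-image {N} D πs U t i i∈U =
  trans (lookup∘tabulate (λ j → anyFin (λ l → lookup U l ∧ edge D πs l j)) j)
        (anyFin-intro (λ l → lookup U l ∧ edge D πs l j) i
                      (cong₂ _∧_ i∈U (cong (_∨ diagonalEdge) (anyFin-intro (λ s → does (lookup (lookup πs s) i ≟ j)) t (dec-true (j ≟ j) refl)))))
  where
  j : Fin N
  j = lookup (lookup πs t) i
  diagonalEdge : Bool
  diagonalEdge = does (i ≟ j) ∧ (toℕ i <ᵇ D)

enlarge : {n : ℕ} (A : Subset n) (w : ℕ) → ∣ A ∣ ≤ w → w ≤ n →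
          Σ[ W ∈ Subset n ] ∣ W ∣ ≡ w × (∀ i → lookup A i ≡ true → lookup W i ≡ true)
enlarge [] zero _ _ = [] , refl , λ ()
enlarge (true ∷ A) (suc w) (s≤s ∣A∣≤w) (s≤s w≤n) with enlarge A w ∣A∣≤w w≤n
... | W , ∣W∣≡w , A⊆W = true ∷ W , cong suc ∣W∣≡w , λ { zero _ → refl ; (suc i) i∈A → A⊆W i i∈A }
enlarge {suc n} (false ∷ A) w ∣A∣≤w w≤1+n with w ≤? n
... | yes w≤n with enlarge A w ∣A∣≤w w≤n
...   | W , ∣W∣≡w , A⊆W = false ∷ W , ∣W∣≡w , λ { zero () ; (suc i) i∈A → A⊆W i i∈A }
enlarge {suc n} (false ∷ A) w ∣A∣≤w w≤1+n | no w≰n with enlarge A n (∣p∣≤n A) ≤-refl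
...   | W , ∣W∣≡n , A⊆W = true ∷ W , trans (cong suc ∣W∣≡n) (≤-antisym (≰⇒> w≰n) w≤1+n)
                        , λ { zero () ; (suc i) i∈A → A⊆W i i∈A }

containsBelow-intro : {n : ℕ} (D : ℕ) (U W : Subset n) →
                      (∀ i → lookup U i ≡ true → toℕ i < D → lookup W i ≡ true) → containsBelow D U W ≡ true
containsBelow-intro zero    U           W       _ = refl
containsBelow-intro (suc D) []          []      _ = refl
containsBelow-intro (suc D) (false ∷ U) (w ∷ W) h = containsBelow-intro D U W (λ i i∈U i<D → h (suc i) i∈U (s≤s i<D))
containsBelow-intro (suc D) (true ∷ U)  (w ∷ W) h =
  cong₂ _∧_ (h zero refl (s≤s z≤n)) (containsBelow-intro D U W (λ i i∈U i<D → h (suc i) i∈U (s≤s i<D)))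

mapsInto-intro : {N n : ℕ} (W : Fin N → Bool) (U : Subset n) (v : Vec (Fin N) n) →
                 (∀ i → lookup U i ≡ true → W (lookup v i) ≡ true) → mapsInto W U v ≡ true
mapsInto-intro W []          []      _ = refl
mapsInto-intro W (false ∷ U) (x ∷ v) h = mapsInto-intro W U v (h ∘ suc)
mapsInto-intro W (true ∷ U)  (x ∷ v) h = cong₂ _∧_ (h zero refl) (mapsInto-intro W U v (h ∘ suc))

every-intro : {d : ℕ} (p : A → Bool) (xs : Vec A d) → (∀ t → p (lookup xs t) ≡ true) → every p xs ≡ true
every-intro p []       _ = refl
every-intro p (x ∷ xs) h = cong₂ _∧_ (h zero) (every-intro p xs (h ∘ suc))

witnesses : {N d : ℕ} (D k w : ℕ) → Subset N → Subset N → Vec (Vec (Fin N) N) d → Bool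
witnesses D k w U W πs = admissible D k w U W ∧ every (mapsInto (lookup W) U) πs

-- The witness W is the neighbourhood of U, enlarged to size w.
badEvent⇒witnessed : ∀ {N d} D k w (πs : Vec (Vec (Fin N) N) d) → suc w ≤ N → badEvent D k (suc w) πs ≡ true →
                     any (λ U → any (λ W → witnesses D k w U W πs) (allSubsets N)) (allSubsets N) ≡ true
badEvent⇒witnessed {N} D k w πs 1+w≤N bad with any-elim _ (allSubsets N) bad
... | U , U-bad with enlarge (nbhd D πs U) w (≤-pred ∣nbhd∣<1+w) (≤-trans (n≤1+n w) 1+w≤N)
  where
  ∣nbhd∣<1+w : ∣ nbhd D πs U ∣ < suc w
  ∣nbhd∣<1+w = <ᵇ⇒< _ _ (Equivalence.from T-≡ (∧-conicalʳ (∣ U ∣ ≡ᵇ k) _ U-bad))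
...   | W , ∣W∣≡w , nbhd⊆W =
  any-intro _ (∈-allSubsets U) (any-intro _ (∈-allSubsets W) (cong₂ _∧_ admissibleUW confinedUW))
  where
  admissibleUW : admissible D k w U W ≡ true
  admissibleUW = cong₂ _∧_ (∧-conicalˡ (∣ U ∣ ≡ᵇ k) _ U-bad)
                           (cong₂ _∧_ (Equivalence.to T-≡ (≡⇒≡ᵇ _ _ ∣W∣≡w))
                                      (containsBelow-intro D U W (λ i i∈U i<D → nbhd⊆W i (nbhd-diagonal D πs U i i∈U i<D))))
  confinedUW : every (mapsInto (lookup W) U) πs ≡ true
  confinedUW = every-intro _ πs (λ t → mapsInto-intro (lookup W) U (lookup πs t) (λ i i∈U → nbhd⊆W _ (nbhd-image D πs U t i i∈U)))

count-witnesses : ∀ N d D k w (U W : Subset N) →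
                  count (witnesses D k w U W) (allPermTuples N d) ≡ 𝟙 (admissible D k w U W) * confined w k N ^ d
count-witnesses N d D k w U W = begin
  count (witnesses D k w U W) (allPermTuples N d)
    ≡⟨ count-guarded (admissible D k w U W) (every (mapsInto (lookup W) U)) (allPermTuples N d) ⟩
  𝟙 (admissible D k w U W) * count (every (mapsInto (lookup W) U)) (allPermTuples N d)
    ≡⟨ cong (𝟙 (admissible D k w U W) *_) (count-every-allVecs (allPerms N) d (mapsInto (lookup W) U)) ⟩
  𝟙 (admissible D k w U W) * count (mapsInto (lookup W) U) (allPerms N) ^ d
    ≡⟨ cong (λ c → 𝟙 (admissible D k w U W) * c ^ d) (count-mapsInto-allPerms (lookup W) U) ⟩
  𝟙 (admissible D k w U W) * confined (count (lookup W) (allFin N)) (∣ U ∣) N ^ d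
    ≡⟨ cong (λ c → 𝟙 (admissible D k w U W) * confined c (∣ U ∣) N ^ d) (count-lookup-allFin W) ⟩
  𝟙 (admissible D k w U W) * confined (∣ W ∣) (∣ U ∣) N ^ d
    ≡⟨ sizes ⟩
  𝟙 (admissible D k w U W) * confined w k N ^ d ∎
  where
  open ≡-Reasoning
  sizes : 𝟙 (admissible D k w U W) * confined (∣ W ∣) (∣ U ∣) N ^ d ≡ 𝟙 (admissible D k w U W) * confined w k N ^ d
  sizes with admissible D k w U W in adm
  ... | false = refl
  ... | true  = cong₂ (λ a b → 1 * confined a b N ^ d)
                      (≡ᵇ-true⇒≡ (∣ W ∣) w (∧-conicalˡ (∣ W ∣ ≡ᵇ w) (containsBelow D U W) (∧-conicalʳ (∣ U ∣ ≡ᵇ k) _ adm)))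
                      (≡ᵇ-true⇒≡ (∣ U ∣) k (∧-conicalˡ (∣ U ∣ ≡ᵇ k) ((∣ W ∣ ≡ᵇ w) ∧ containsBelow D U W) adm))

count-badEvent≤ : ∀ N d D k w → suc w ≤ N →
                  count (badEvent D k (suc w)) (allPermTuples N d) ≤ admissiblePairs N D k w * confined w k N ^ d
count-badEvent≤ N d D k w 1+w≤N = begin
  count (badEvent D k (suc w)) Πs
    ≤⟨ count-mono Πs (λ πs → badEvent⇒witnessed D k w πs 1+w≤N) ⟩
  count (λ πs → any (λ U → any (λ W → witnesses D k w U W πs) S) S) Πs
    ≤⟨ count-any≤sum (λ U πs → any (λ W → witnesses D k w U W πs) S) S Πs ⟩
  sumBy (λ U → count (λ πs → any (λ W → witnesses D k w U W πs) S) Πs) S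
    ≤⟨ sumBy-mono S (λ U → count-any≤sum (witnesses D k w U) S Πs) ⟩
  sumBy (λ U → sumBy (λ W → count (witnesses D k w U W) Πs) S) S
    ≡⟨ sumBy-cong S (λ U → trans (sumBy-cong S (count-witnesses N d D k w U)) (sumBy-*ʳ _ _ S)) ⟩
  sumBy (λ U → count (admissible D k w U) S * confined w k N ^ d) S
    ≡⟨ sumBy-*ʳ _ _ S ⟩
  admissiblePairs N D k w * confined w k N ^ d ∎
  where
  open ≤-Reasoning
  S : List (Subset N)
  S = allSubsets N
  Πs : List (Vec (Vec (Fin N) N) d)
  Πs = allPermTuples N d

-- Fractions of natural numbers

frac : ℕ → ℕ → ℚ
frac a b = ℕtoℚ a ÷ℕ b

toℚᵘ-ℕtoℚ : ∀ a → toℚᵘ (ℕtoℚ a) ≃ᵘ mkℚᵘ (ℤ.+ a) 0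
toℚᵘ-ℕtoℚ a = ℚᵘP.≃-reflexive (cong toℚᵘ (normalize-coprime (Coprime.sym (1-coprimeTo a))))

toℚᵘ-frac : ∀ a b → toℚᵘ (frac a (suc b)) ≃ᵘ mkℚᵘ (ℤ.+ a) b
toℚᵘ-frac a b = begin
  toℚᵘ (ℕtoℚ a *ℚ (ℤ.+ 1 ℚ./ suc b))                    ≈⟨ toℚᵘ-homo-* (ℕtoℚ a) (ℤ.+ 1 ℚ./ suc b) ⟩
  toℚᵘ (ℕtoℚ a) *ᵘ toℚᵘ (ℤ.+ 1 ℚ./ suc b)            ≈⟨ ℚᵘP.*-cong (toℚᵘ-ℕtoℚ a) 1/[1+b] ⟩
  mkℚᵘ (ℤ.+ a) 0 *ᵘ mkℚᵘ (ℤ.+ 1) b                     ≈⟨ *≡* (cong₂ ℤ._*_ (ℤP.*-identityʳ (ℤ.+ a)) (cong (λ z → ℤ.+ suc z) (sym (+-identityʳ b)))) ⟩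
  mkℚᵘ (ℤ.+ a) b                                        ∎
  where
  open ℚᵘP.≃-Reasoning
  1/[1+b] : toℚᵘ (ℤ.+ 1 ℚ./ suc b) ≃ᵘ mkℚᵘ (ℤ.+ 1) b
  1/[1+b] = ℚᵘP.≃-reflexive (cong toℚᵘ (normalize-coprime (1-coprimeTo (suc b))))

frac-cross : ∀ {a b c e} → 0 < b → 0 < e → a * e ≡ c * b → frac a b ≡ frac c e
frac-cross {a} {suc b} {c} {suc e} _ _ a*e≡c*b = toℚᵘ-injective (begin
  toℚᵘ (frac a (suc b))  ≈⟨ toℚᵘ-frac a b ⟩
  mkℚᵘ (ℤ.+ a) b         ≈⟨ *≡* (trans (sym (ℤP.pos-* a (suc e))) (trans (cong ℤ.+_ a*e≡c*b) (ℤP.pos-* c (suc b)))) ⟩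
  mkℚᵘ (ℤ.+ c) e         ≈⟨ toℚᵘ-frac c e ⟨
  toℚᵘ (frac c (suc e))  ∎)
  where open ℚᵘP.≃-Reasoning

frac-* : ∀ a {b} c {e} → 0 < b → 0 < e → frac a b *ℚ frac c e ≡ frac (a * c) (b * e)
frac-* a {suc b} c {suc e} _ _ = toℚᵘ-injective (begin
  toℚᵘ (frac a (suc b) *ℚ frac c (suc e))            ≈⟨ toℚᵘ-homo-* (frac a (suc b)) (frac c (suc e)) ⟩
  toℚᵘ (frac a (suc b)) *ᵘ toℚᵘ (frac c (suc e))     ≈⟨ ℚᵘP.*-cong (toℚᵘ-frac a b) (toℚᵘ-frac c e) ⟩
  mkℚᵘ (ℤ.+ a) b *ᵘ mkℚᵘ (ℤ.+ c) e                   ≈⟨ *≡* (cong (ℤ._* ℤ.+ (suc b * suc e)) (sym (ℤP.pos-* a c))) ⟩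
  mkℚᵘ (ℤ.+ (a * c)) (e + b * suc e)                 ≈⟨ toℚᵘ-frac (a * c) (e + b * suc e) ⟨
  toℚᵘ (frac (a * c) (suc b * suc e))                ∎)
  where open ℚᵘP.≃-Reasoning

frac-monoˡ-≤ : ∀ {a c} b → 0 < b → a ≤ c → frac a b ≤ℚ frac c b
frac-monoˡ-≤ {a} {c} (suc b) _ a≤c =
  toℚᵘ-cancel-≤ (ℚᵘP.≤-respˡ-≃ (ℚᵘP.≃-sym (toℚᵘ-frac a b)) (ℚᵘP.≤-respʳ-≃ (ℚᵘP.≃-sym (toℚᵘ-frac c b))
    (*≤* (ℤP.*-monoʳ-≤-nonNeg (ℤ.+ suc b) (ℤ.+≤+ a≤c)))))

frac-/1 : ∀ a → frac a 1 ≡ ℕtoℚ a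
frac-/1 a = ℚP.*-identityʳ (ℕtoℚ a)

frac-zero : ∀ b → frac 0 b ≡ 0ℚ
frac-zero zero    = refl
frac-zero (suc b) = ℚP.*-zeroˡ (ℤ.+ 1 ℚ./ suc b)

frac-cancel : ∀ a {b} → 0 < b → frac (a * b) b ≡ ℕtoℚ a
frac-cancel a {b} 0<b = trans (frac-cross {a * b} {b} {a} {1} 0<b (s≤s z≤n) (*-identityʳ (a * b))) (frac-/1 a)

ℕtoℚ*frac : ∀ a c {b} → 0 < b → ℕtoℚ a *ℚ frac c b ≡ frac (a * c) b
ℕtoℚ*frac a c {b} 0<b =
  trans (cong (_*ℚ frac c b) (sym (frac-/1 a))) (trans (frac-* a {1} c {b} (s≤s z≤n) 0<b) (cong (frac (a * c)) (*-identityˡ b)))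

frac-^ : ∀ a {b} d → 0 < b → frac a b ^ℚ d ≡ frac (a ^ d) (b ^ d)
frac-^ a     zero    _   = refl
frac-^ a {b} (suc d) 0<b = trans (cong (frac a b *ℚ_) (frac-^ a d 0<b)) (frac-* a (a ^ d) 0<b (m^n>0 b {{>-nonZero 0<b}} d))

ℕtoℚ-+ : ∀ a c → ℕtoℚ (a + c) ≡ ℕtoℚ a +ℚ ℕtoℚ c
ℕtoℚ-+ a c = toℚᵘ-injective (begin
  toℚᵘ (ℕtoℚ (a + c))                   ≈⟨ toℚᵘ-ℕtoℚ (a + c) ⟩
  mkℚᵘ (ℤ.+ (a + c)) 0                  ≈⟨ *≡* (cong (ℤ._* ℤ.+ 1) (trans (ℤP.pos-+ a c) (sym (cong₂ ℤ._+_ (ℤP.*-identityʳ (ℤ.+ a)) (ℤP.*-identityʳ (ℤ.+ c)))))) ⟩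
  mkℚᵘ (ℤ.+ a) 0 +ᵘ mkℚᵘ (ℤ.+ c) 0      ≈⟨ ℚᵘP.+-cong (toℚᵘ-ℕtoℚ a) (toℚᵘ-ℕtoℚ c) ⟨
  toℚᵘ (ℕtoℚ a) +ᵘ toℚᵘ (ℕtoℚ c)        ≈⟨ toℚᵘ-homo-+ (ℕtoℚ a) (ℕtoℚ c) ⟨
  toℚᵘ (ℕtoℚ a +ℚ ℕtoℚ c)               ∎)
  where open ℚᵘP.≃-Reasoning

∑<ℚ : ℕ → (ℕ → ℚ) → ℚ
∑<ℚ zero    f = 0ℚ
∑<ℚ (suc K) f = f 0 +ℚ ∑<ℚ K (f ∘ suc)

sumTo≡∑<ℚ : ∀ k f → sumTo k f ≡ ∑<ℚ (suc k) f
sumTo≡∑<ℚ k f = foldr-applyUpTo id (suc k)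
  where
  foldr-applyUpTo : ∀ (h : ℕ → ℕ) n → foldr (λ i acc → f i +ℚ acc) 0ℚ (applyUpTo h n) ≡ ∑<ℚ n (f ∘ h)
  foldr-applyUpTo h zero    = refl
  foldr-applyUpTo h (suc n) = cong (f (h 0) +ℚ_) (foldr-applyUpTo (h ∘ suc) n)

ℕtoℚ-∑< : ∀ K f → ℕtoℚ (∑< K f) ≡ ∑<ℚ K (ℕtoℚ ∘ f)
ℕtoℚ-∑< zero    f = refl
ℕtoℚ-∑< (suc K) f = trans (ℕtoℚ-+ (f 0) _) (cong (ℕtoℚ (f 0) +ℚ_) (ℕtoℚ-∑< K (f ∘ suc)))

∑<ℚ-distribˡ : ∀ c K f → c *ℚ ∑<ℚ K f ≡ ∑<ℚ K (λ i → c *ℚ f i)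
∑<ℚ-distribˡ c zero    f = ℚP.*-zeroʳ c
∑<ℚ-distribˡ c (suc K) f = trans (ℚP.*-distribˡ-+ c (f 0) _) (cong (c *ℚ f 0 +ℚ_) (∑<ℚ-distribˡ c K (f ∘ suc)))

∑<ℚ-cong : ∀ K {f g : ℕ → ℚ} → (∀ i → i < K → f i ≡ g i) → ∑<ℚ K f ≡ ∑<ℚ K g
∑<ℚ-cong zero    f≗g = refl
∑<ℚ-cong (suc K) f≗g = cong₂ _+ℚ_ (f≗g 0 (s≤s z≤n)) (∑<ℚ-cong K (λ i i<K → f≗g (suc i) (s≤s i<K)))

∑<ℚ-zero : ∀ K → ∑<ℚ K (λ _ → 0ℚ) ≡ 0ℚ
∑<ℚ-zero zero    = refl
∑<ℚ-zero (suc K) = trans (ℚP.+-identityˡ _) (∑<ℚ-zero K)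

-- The bound as a single fraction

pairBound : ℕ → ℕ → ℕ → ℕ → ℕ
pairBound N D k w = ∑[ i < suc k ] ((D C i) * ((N ∸ D) C (k ∸ i)) * supersets N i w)

wCk/NCk≡confined/N! : ∀ N w k → k ≤ N → frac (w C k) (N C k) ≡ frac (confined w k N) (N !)
wCk/NCk≡confined/N! N w k k≤N = frac-cross {w C k} {N C k} {confined w k N} {N !} (nCk>0 k≤N) (1≤n! N) (begin
  (w C k) * N !                              ≡⟨ cong ((w C k) *_) (nCk*k!*[n∸k]!≡n! k≤N) ⟨
  (w C k) * ((N C k) * (k ! * (N ∸ k) !))    ≡⟨ *-leftSwap (w C k) (N C k) _ ⟩
  (N C k) * ((w C k) * (k ! * (N ∸ k) !))    ≡⟨ cong ((N C k) *_) (*-assoc (w C k) (k !) _) ⟨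
  (N C k) * ((w C k) * k ! * (N ∸ k) !)      ≡⟨ cong (λ c → (N C k) * (c * (N ∸ k) !)) (nP′k≡nCk*k! w k) ⟨
  (N C k) * confined w k N                   ≡⟨ *-comm (N C k) _ ⟩
  confined w k N * (N C k)                   ∎)
  where open ≡-Reasoning

supersetTerm : ∀ N D k w i → i ≤ N →
               ℕtoℚ (N C w) *ℚ frac ((D C i) * ((N ∸ D) C (k ∸ i)) * (w C i)) (N C i)
                 ≡ ℕtoℚ ((D C i) * ((N ∸ D) C (k ∸ i)) * supersets N i w)
supersetTerm N D k w i i≤N = begin
  ℕtoℚ (N C w) *ℚ frac (a * (w C i)) (N C i)  ≡⟨ ℕtoℚ*frac (N C w) (a * (w C i)) (nCk>0 i≤N) ⟩
  frac ((N C w) * (a * (w C i))) (N C i)      ≡⟨ cong (λ c → frac c (N C i)) rearranged ⟩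
  frac (a * supersets N i w * (N C i)) (N C i) ≡⟨ frac-cancel (a * supersets N i w) (nCk>0 i≤N) ⟩
  ℕtoℚ (a * supersets N i w)                  ∎
  where
  open ≡-Reasoning
  a : ℕ
  a = (D C i) * ((N ∸ D) C (k ∸ i))
  rearranged : (N C w) * (a * (w C i)) ≡ a * supersets N i w * (N C i)
  rearranged = trans (*-leftSwap (N C w) a (w C i))
                     (trans (cong (a *_) (sym (supersets*nCi≡nCw*wCi N i w i≤N))) (sym (*-assoc a _ (N C i))))

bound≡frac : ∀ N d D k w → k ≤ N → bound N d D k (suc w) ≡ frac (pairBound N D k w * confined w k N ^ d) ((N !) ^ d)
bound≡frac N d D k w k≤N = begin
  ℕtoℚ (N C w) *ℚ (frac (w C k) (N C k) ^ℚ d) *ℚ sumTo k term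
    ≡⟨ cong₂ (λ x y → ℕtoℚ (N C w) *ℚ x *ℚ y) probability (sumTo≡∑<ℚ k term) ⟩
  ℕtoℚ (N C w) *ℚ P *ℚ ∑<ℚ (suc k) term
    ≡⟨ trans (cong (_*ℚ ∑<ℚ (suc k) term) (ℚP.*-comm (ℕtoℚ (N C w)) P)) (ℚP.*-assoc P _ _) ⟩
  P *ℚ (ℕtoℚ (N C w) *ℚ ∑<ℚ (suc k) term)
    ≡⟨ cong (P *ℚ_) sum ⟩
  P *ℚ ℕtoℚ (pairBound N D k w)
    ≡⟨ ℚP.*-comm P _ ⟩
  ℕtoℚ (pairBound N D k w) *ℚ P
    ≡⟨ ℕtoℚ*frac (pairBound N D k w) _ N!^d>0 ⟩
  frac (pairBound N D k w * confined w k N ^ d) ((N !) ^ d) ∎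
  where
  open ≡-Reasoning
  term : ℕ → ℚ
  term i = frac ((D C i) * ((N ∸ D) C (k ∸ i)) * (w C i)) (N C i)
  P : ℚ
  P = frac (confined w k N ^ d) ((N !) ^ d)
  N!^d>0 : 0 < (N !) ^ d
  N!^d>0 = m^n>0 (N !) {{>-nonZero (1≤n! N)}} d
  probability : frac (w C k) (N C k) ^ℚ d ≡ P
  probability = trans (cong (_^ℚ d) (wCk/NCk≡confined/N! N w k k≤N)) (frac-^ (confined w k N) d (1≤n! N))
  sum : ℕtoℚ (N C w) *ℚ ∑<ℚ (suc k) term ≡ ℕtoℚ (pairBound N D k w)
  sum = begin
    ℕtoℚ (N C w) *ℚ ∑<ℚ (suc k) term
      ≡⟨ ∑<ℚ-distribˡ (ℕtoℚ (N C w)) (suc k) term ⟩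
    ∑<ℚ (suc k) (λ i → ℕtoℚ (N C w) *ℚ term i)
      ≡⟨ ∑<ℚ-cong (suc k) (λ i i<1+k → supersetTerm N D k w i (≤-trans (≤-pred i<1+k) k≤N)) ⟩
    ∑<ℚ (suc k) (λ i → ℕtoℚ ((D C i) * ((N ∸ D) C (k ∸ i)) * supersets N i w))
      ≡⟨ ℕtoℚ-∑< (suc k) (λ i → (D C i) * ((N ∸ D) C (k ∸ i)) * supersets N i w) ⟨
    ℕtoℚ (pairBound N D k w) ∎

length-allPermTuples : ∀ N d → length (allPermTuples N d) ≡ (N !) ^ d
length-allPermTuples N d = trans (length-allVecs (allPerms N) d) (cong (_^ d) (length-allPerms N))

probBad≤bound : ∀ N d D k w → k ≤ N → suc w ≤ N → probBad N d D k (suc w) ≤ℚ bound N d D k (suc w)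
probBad≤bound N d D k w k≤N 1+w≤N = begin
  probBad N d D k (suc w)
    ≡⟨ cong₂ frac (length-filter-true (badEvent D k (suc w)) (allPermTuples N d)) (length-allPermTuples N d) ⟩
  frac (count (badEvent D k (suc w)) (allPermTuples N d)) ((N !) ^ d)
    ≤⟨ frac-monoˡ-≤ ((N !) ^ d) (m^n>0 (N !) {{>-nonZero (1≤n! N)}} d)
         (≤-trans (count-badEvent≤ N d D k w 1+w≤N) (*-monoˡ-≤ (confined w k N ^ d) (admissiblePairs≤ N D k w))) ⟩
  frac (pairBound N D k w * confined w k N ^ d) ((N !) ^ d)
    ≡⟨ bound≡frac N d D k w k≤N ⟨
  bound N d D k (suc w) ∎
  where open ℚP.≤-Reasoning

bound-withoutDiagonal : ∀ N d k m → bound N d 0 k m ≡ bound0 N d k m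
bound-withoutDiagonal N d k m = begin
  ℕtoℚ (N C (m ∸ 1)) *ℚ P *ℚ sumTo k term
    ≡⟨ cong (ℕtoℚ (N C (m ∸ 1)) *ℚ P *ℚ_) onlyEmptyIntersection ⟩
  ℕtoℚ (N C (m ∸ 1)) *ℚ P *ℚ ℕtoℚ (N C k)
    ≡⟨ ℚP.*-comm _ (ℕtoℚ (N C k)) ⟩
  ℕtoℚ (N C k) *ℚ (ℕtoℚ (N C (m ∸ 1)) *ℚ P)
    ≡⟨ ℚP.*-assoc (ℕtoℚ (N C k)) _ P ⟨
  ℕtoℚ (N C k) *ℚ ℕtoℚ (N C (m ∸ 1)) *ℚ P ∎
  where
  open ≡-Reasoning
  P : ℚ
  P = (ℕtoℚ ((m ∸ 1) C k) ÷ℕ (N C k)) ^ℚ d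
  term : ℕ → ℚ
  term i = frac ((0 C i) * ((N ∸ 0) C (k ∸ i)) * ((m ∸ 1) C i)) (N C i)
  term-suc≡0 : ∀ i → term (suc i) ≡ 0ℚ
  term-suc≡0 i = trans (cong (λ c → frac (c * ((N ∸ 0) C (k ∸ suc i)) * ((m ∸ 1) C suc i)) (N C suc i))
                             (k>n⇒nCk≡0 {0} {suc i} (s≤s z≤n)))
                       (frac-zero (N C suc i))
  onlyEmptyIntersection : sumTo k term ≡ ℕtoℚ (N C k)
  onlyEmptyIntersection = begin
    sumTo k term                    ≡⟨ sumTo≡∑<ℚ k term ⟩
    term 0 +ℚ ∑<ℚ k (term ∘ suc)    ≡⟨ cong (term 0 +ℚ_) (trans (∑<ℚ-cong k (λ i _ → term-suc≡0 i)) (∑<ℚ-zero k)) ⟩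
    term 0 +ℚ 0ℚ                    ≡⟨ ℚP.+-identityʳ (term 0) ⟩
    frac (1 * (N C k) * 1) 1        ≡⟨ cong (λ c → frac c 1) (trans (*-identityʳ (1 * (N C k))) (*-identityˡ (N C k))) ⟩
    frac (N C k) 1                  ≡⟨ frac-/1 (N C k) ⟩
    ℕtoℚ (N C k)                    ∎

floorMul-zero : ∀ N → floorMul 0ℚ N ≡ 0
floorMul-zero N = cong (λ q → ℤ.∣ ℚ.floor q ∣) (ℚP.*-zeroˡ (ℕtoℚ N))

lemma6p1 : (d : ℕ) (δ : ℚ) (N k m : ℕ) → 0ℚ ≤ℚ δ → δ <ℚ 1ℚ → 1 ≤ k → k ≤ N → 1 ≤ m → m ≤ N →
    (probBad N d (floorMul δ N) k m ≤ℚ bound N d (floorMul δ N) k m)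
      × (δ ≡ 0ℚ → bound N d (floorMul δ N) k m ≡ bound0 N d k m)
lemma6p1 d δ N k (suc w) _ _ _ k≤N _ 1+w≤N =
  probBad≤bound N d (floorMul δ N) k w k≤N 1+w≤N ,
  λ { refl → trans (cong (λ D → bound N d D k (suc w)) (floorMul-zero N)) (bound-withoutDiagonal N d k (suc w)) }
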